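{- Let $X$ be a finite temporal Esakia space and $x,y\in X$. Then $y$ is topo-reachable from $x$ (i.e. $x\trianglelefteq y$) if and only if $xZy$ holds in the underlying temporal transit of $X$.
   Context: A temporal Esakia space is a structure $(X,R^{\triangleleft},R^{\triangleright},\le,\Omega)$ such that $(X,\le,\Omega)$ is an Esakia space, $\le$ is the reflexive closure $R^{\triangleright}\cup\Delta_X$ of $R^{\triangleright}$, $R^{\triangleleft}$ is the converse of $R^{\triangleright}$, for every clopen upset $K$ the sets $\{x:R^{\triangleright}[x]\subseteq K\}$ and $R^{\triangleright}[K]$ are clopen upsets, and for every $x$ the sets $R^{\triangleright}[x]$, $R^{\triangleleft}[x]$ are closed. Its underlying temporal transit is $(X,R^{\triangleleft},R^{\triangleright},\le)$. A subset $S$ is archival if for all $x,z$: if $x\notin S$, $z\in S$ and $zR^{\triangleleft}x$, then $R^{\triangleleft}[z]\cap{\uparrow}x\cap S\neq\emptyset$. $x\trianglelefteq y$ means $y$ belongs to every closed archival upset containing $x$. $\mathrm{Refl}(X)=\{v:vR^{\triangleright}v\}$; $xBw$ means $w\le x$ and $\{v:w<v\le x\}\cap\mathrm{Refl}(X)=\emptyset$; with $R;R'=\{(x,z):\exists y\,(xRy,\ yR'z)\}$, $Z_0=\Delta_X$, $Z_{n+1}=Z_n;B;\le$, $Z=\bigcup_n Z_n$. -}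

module Defs where

open import Data.Nat using (ℕ; zero; suc)
open import Data.Fin using (Fin)
open import Data.Bool using (Bool; T; not)
open import Data.Product using (Σ; ∃; ∃-syntax; _×_; _,_)
open import Data.Sum using (_⊎_)
open import Relation.Nullary using (¬_)
open import Relation.Binary.PropositionalEquality using (_≡_; _≢_)
open import Level using (0ℓ) renaming (suc to lsuc)

Subset : ℕ → Set
Subset n = Fin n → Bool

_∈_ : ∀ {n} → Fin n → Subset n → Set
x ∈ S = T (S x)

_∪_ : ∀ {n} → Subset n → Subset n → Subset n
(S ∪ S') x = Data.Bool._∨_ (S x) (S' x)

_∩_ : ∀ {n} → Subset n → Subset n → Subset n
(S ∩ S') x = Data.Bool._∧_ (S x) (S' x)

∁ : ∀ {n} → Subset n → Subset n
∁ S x = not (S x)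

_⇔_ : Set → Set → Set
A ⇔ B = (A → B) × (B → A)

record FinTemporalEsakia (n : ℕ) : Set₁ where
  field
    r▷ : Fin n → Fin n → Bool
    Open : Subset n → Set

  _R▷_ : Fin n → Fin n → Set
  x R▷ y = T (r▷ x y)

  _R◁_ : Fin n → Fin n → Set
  x R◁ y = y R▷ x

  _≤_ : Fin n → Fin n → Set
  x ≤ y = (x ≡ y) ⊎ (x R▷ y)

  _<_ : Fin n → Fin n → Set
  x < y = (x ≤ y) × (x ≢ y)

  Closed : Subset n → Set
  Closed S = Open (∁ S)

  Clopen : Subset n → Set
  Clopen S = Open S × Closed S

  IsUpset : (Fin n → Set) → Set
  IsUpset P = ∀ x y → x ≤ y → P x → P y

  IsDownset : (Fin n → Set) → Set
  IsDownset P = ∀ x y → y ≤ x → P x → P y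

  ClopenUpsetP : (Fin n → Set) → Set
  ClopenUpsetP P = Σ (Subset n) λ S → (∀ x → (x ∈ S) ⇔ P x) × Clopen S × IsUpset (_∈ S)

  ClopenP : (Fin n → Set) → Set
  ClopenP P = Σ (Subset n) λ S → (∀ x → (x ∈ S) ⇔ P x) × Clopen S

  ClosedP : (Fin n → Set) → Set
  ClosedP P = Σ (Subset n) λ S → (∀ x → (x ∈ S) ⇔ P x) × Closed S

  field
    -- Ω is a topology (on a finite set, closure under finite unions suffices)
    Open-ext  : ∀ S S' → (∀ x → S x ≡ S' x) → Open S → Open S'
    Open-∅    : Open (λ _ → Bool.false)
    Open-full : Open (λ _ → Bool.true)
    Open-∪    : ∀ S S' → Open S → Open S' → Open (S ∪ S')
    Open-∩    : ∀ S S' → Open S → Open S' → Open (S ∩ S')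
    -- ≤ is a partial order (reflexivity is automatic)
    ≤-trans   : ∀ x y z → x ≤ y → y ≤ z → x ≤ z
    ≤-antisym : ∀ x y → x ≤ y → y ≤ x → x ≡ y
    -- Priestley separation axiom (compactness is automatic: X is finite)
    priestley : ∀ x y → ¬ (x ≤ y) →
                Σ (Subset n) λ U → Clopen U × IsUpset (_∈ U) × (x ∈ U) × ¬ (y ∈ U)
    esakia    : ∀ U → Clopen U → ClopenP (λ x → ∃[ u ] (u ∈ U × x ≤ u))
    box-clopen : ∀ K → Clopen K → IsUpset (_∈ K) →
                 ClopenUpsetP (λ x → ∀ y → x R▷ y → y ∈ K)
    dia-clopen : ∀ K → Clopen K → IsUpset (_∈ K) →
                 ClopenUpsetP (λ y → ∃[ k ] (k ∈ K × k R▷ y))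
    R▷-closed  : ∀ x → ClosedP (λ y → x R▷ y)
    R◁-closed  : ∀ x → ClosedP (λ y → x R◁ y)

  Archival : Subset n → Set
  Archival S = ∀ x z → ¬ (x ∈ S) → z ∈ S → z R◁ x →
               ∃[ w ] (z R◁ w × x ≤ w × w ∈ S)

  _⊴_ : Fin n → Fin n → Set
  x ⊴ y = ∀ S → Closed S → Archival S → IsUpset (_∈ S) → x ∈ S → y ∈ S

  Refl : Fin n → Set
  Refl v = v R▷ v

  _B_ : Fin n → Fin n → Set
  x B w = (w ≤ x) × (∀ v → w < v → v ≤ x → ¬ Refl v)

  Zₙ : ℕ → Fin n → Fin n → Set
  Zₙ zero x z = x ≡ z
  Zₙ (suc k) x z = ∃[ y ] (Zₙ k x y × ∃[ u ] (y B u × u ≤ z))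

  _Z_ : Fin n → Fin n → Set
  x Z y = ∃[ k ] Zₙ k x y

-- A finite Priestley space is discrete, so x ⊴ y says that y lies in every archival
-- upset containing x, while Z is reachability along steps y B u ≤ z.
-- Archival upsets are closed under these steps: if y ∈ S, y B u and u ∉ S, take m ∈ S
-- minimal with u < m ≤ y; archivality applied to u R▷ m yields w ∈ S with u ≤ w R▷ m,
-- minimality forces w = m, so m is reflexive, contradicting y B u.
-- Conversely the set S of points Z-reachable from x is an archival upset: for x' ∉ S,
-- z ∈ S and x' R▷ z, if no reflexive point lies strictly above x' and below z then
-- z B x', so x' ∈ S; otherwise a maximal such point m satisfies z B m and witnesses
-- archivality.  S is a decidable subset because the stages Zₖ stabilise.
module Submission where

open import Defs
open import Data.Nat using (ℕ; zero; suc)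
open import Data.Fin using (Fin; _≟_) renaming (zero to fzero; suc to fsuc)
open import Data.Fin.Properties using (any?; all?)
open import Data.Fin.Induction using (po-wellFounded; po-noetherian)
import Data.Fin.Subset as FinSubset
open import Data.Fin.Subset.Induction using (⊃-wellFounded)
open import Data.Vec using (tabulate)
open import Data.Vec.Properties using (lookup∘tabulate; []=⇒lookup; lookup⇒[]=)
open import Data.Bool using (true; false; T; not; _∧_)
open import Data.Bool.Properties using (T-≡; T-∧; T-∨)
open import Data.Product using (∃-syntax; _×_; _,_; proj₁; proj₂)
open import Data.Sum using (inj₁; inj₂)
open import Data.Unit using (tt)
open import Data.Empty using (⊥-elim)
open import Function using (_∘_; flip)
open import Function.Bundles using (Equivalence)
open import Induction.WellFounded using (WellFounded; Acc; acc)
open import Relation.Binary using (Rel; IsPartialOrder)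
  renaming (Decidable to Decidable₂)
open import Relation.Binary.PropositionalEquality
  using (_≡_; _≢_; refl; sym; trans; subst; isEquivalence)
import Relation.Binary.Construct.NonStrictToStrict as ToStrict
open import Relation.Nullary using (¬_; yes; no)
open import Relation.Nullary.Decidable.Core
  using (_×-dec_; _⊎-dec_; _→-dec_; ¬?; T?; isYes; toWitness; fromWitness; decidable-stable)
open import Relation.Unary using (Pred; Decidable)

¬T⇒T-not : ∀ {b} → ¬ T b → T (not b)
¬T⇒T-not {true}  ¬b = ⊥-elim (¬b tt)
¬T⇒T-not {false} _  = tt

T⇒¬T-not : ∀ {b} → T b → ¬ T (not b)
T⇒¬T-not {true}  _ ()
T⇒¬T-not {false} ()

T-extensional : ∀ {a b} → (T a → T b) → (T b → T a) → a ≡ b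
T-extensional {true}  {true}  _ _ = refl
T-extensional {true}  {false} f _ = ⊥-elim (f tt)
T-extensional {false} {true}  _ g = ⊥-elim (g tt)
T-extensional {false} {false} _ _ = refl

module _ {m ℓ p} {_⊏_ : Rel (Fin m) ℓ} (⊏-wellFounded : WellFounded _⊏_)
         (_⊏?_ : Decidable₂ _⊏_) {P : Pred (Fin m) p} (P? : Decidable P) where

  ∃-minimal : ∀ {a} → P a → ∃[ b ] (P b × ∀ c → P c → ¬ c ⊏ b)
  ∃-minimal {a} = go (⊏-wellFounded a)
    where
    go : ∀ {a} → Acc _⊏_ a → P a → ∃[ b ] (P b × ∀ c → P c → ¬ c ⊏ b)
    go {a} (acc rec) Pa with any? (λ c → P? c ×-dec c ⊏? a)
    ... | yes (c , Pc , c⊏a) = go (rec c⊏a) Pc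
    ... | no ∄c = a , Pa , λ c Pc c⊏a → ∄c (c , Pc , c⊏a)

module _ {m : ℕ} where

  private
    ∈-tabulate⁺ : ∀ {S : Subset m} {i} → i ∈ S → i FinSubset.∈ tabulate S
    ∈-tabulate⁺ {S} {i} i∈S =
      lookup⇒[]= i (tabulate S) (trans (lookup∘tabulate S i) (Equivalence.to T-≡ i∈S))

    ∈-tabulate⁻ : ∀ {S : Subset m} {i} → i FinSubset.∈ tabulate S → i ∈ S
    ∈-tabulate⁻ {S} {i} i∈S =
      Equivalence.from T-≡ (trans (sym (lookup∘tabulate S i)) ([]=⇒lookup i∈S))

  ascending-chain-stabilises : (s : ℕ → Subset m) → (∀ k {i} → i ∈ s k → i ∈ s (suc k)) →
                               ∃[ j ] (∀ {i} → i ∈ s (suc j) → i ∈ s j)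
  ascending-chain-stabilises s s-mono = go 0 (⊃-wellFounded (tabulate (s 0)))
    where
    go : ∀ k → Acc FinSubset._⊃_ (tabulate (s k)) → ∃[ j ] (∀ {i} → i ∈ s (suc j) → i ∈ s j)
    go k (acc rec) with any? (λ i → T? (s (suc k) i) ×-dec ¬? (T? (s k i)))
    ... | yes (i , new , ¬old) =
      go (suc k) (rec ( (λ i∈ → ∈-tabulate⁺ (s-mono k (∈-tabulate⁻ i∈)))
                      , i , ∈-tabulate⁺ new , ¬old ∘ ∈-tabulate⁻))
    ... | no ∄new = k , λ i∈ → decidable-stable (T? _) (λ i∉ → ∄new (_ , i∈ , i∉))

module FiniteT₁Space {n : ℕ} (Open : Subset n → Set)
  (Open-ext  : ∀ S S' → (∀ x → S x ≡ S' x) → Open S → Open S')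
  (Open-∅    : Open (λ _ → false))
  (Open-full : Open (λ _ → true))
  (Open-∪    : ∀ S S' → Open S → Open S' → Open (S ∪ S'))
  (Open-∩    : ∀ S S' → Open S → Open S' → Open (S ∩ S'))
  (separate  : ∀ x y → x ≢ y → ∃[ V ] (Open V × x ∈ V × ¬ y ∈ V)) where

  ⋂ : ∀ {m} → (Fin m → Subset n) → Subset n
  ⋂ {zero}  F _ = true
  ⋂ {suc m} F   = F fzero ∩ ⋂ (F ∘ fsuc)

  ⋃ : ∀ {m} → (Fin m → Subset n) → Subset n
  ⋃ {zero}  F _ = false
  ⋃ {suc m} F   = F fzero ∪ ⋃ (F ∘ fsuc)

  Open-⋂ : ∀ {m} (F : Fin m → Subset n) → (∀ i → Open (F i)) → Open (⋂ F)
  Open-⋂ {zero}  F _ = Open-full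
  Open-⋂ {suc m} F O = Open-∩ _ _ (O fzero) (Open-⋂ (F ∘ fsuc) (O ∘ fsuc))

  Open-⋃ : ∀ {m} (F : Fin m → Subset n) → (∀ i → Open (F i)) → Open (⋃ F)
  Open-⋃ {zero}  F _ = Open-∅
  Open-⋃ {suc m} F O = Open-∪ _ _ (O fzero) (Open-⋃ (F ∘ fsuc) (O ∘ fsuc))

  ∈-⋂ : ∀ {m} (F : Fin m → Subset n) {x} → (∀ i → x ∈ F i) → x ∈ ⋂ F
  ∈-⋂ {zero}  F _   = tt
  ∈-⋂ {suc m} F x∈F = Equivalence.from T-∧ (x∈F fzero , ∈-⋂ (F ∘ fsuc) (x∈F ∘ fsuc))

  ⋂-⊆ : ∀ {m} (F : Fin m → Subset n) {x} i → x ∈ ⋂ F → x ∈ F i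
  ⋂-⊆ F fzero    x∈⋂ = proj₁ (Equivalence.to T-∧ x∈⋂)
  ⋂-⊆ F (fsuc i) x∈⋂ = ⋂-⊆ (F ∘ fsuc) i (proj₂ (Equivalence.to T-∧ x∈⋂))

  ⊆-⋃ : ∀ {m} (F : Fin m → Subset n) {x} i → x ∈ F i → x ∈ ⋃ F
  ⊆-⋃ F fzero    x∈F = Equivalence.from T-∨ (inj₁ x∈F)
  ⊆-⋃ F (fsuc i) x∈F = Equivalence.from T-∨ (inj₂ (⊆-⋃ (F ∘ fsuc) i x∈F))

  ∈-⋃⁻ : ∀ {m} (F : Fin m → Subset n) {x} → x ∈ ⋃ F → ∃[ i ] x ∈ F i
  ∈-⋃⁻ {zero}  F ()
  ∈-⋃⁻ {suc m} F x∈⋃ with Equivalence.to T-∨ x∈⋃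
  ... | inj₁ x∈F₀ = fzero , x∈F₀
  ... | inj₂ x∈⋃′ with ∈-⋃⁻ (F ∘ fsuc) x∈⋃′
  ...   | i , x∈Fᵢ = fsuc i , x∈Fᵢ

  private
    neighbourhood-avoiding : ∀ x y → ∃[ V ] (Open V × x ∈ V × (x ≢ y → ¬ y ∈ V))
    neighbourhood-avoiding x y with x ≟ y
    ... | yes x≡y = (λ _ → true) , Open-full , tt , λ x≢y _ → x≢y x≡y
    ... | no x≢y  = let V , O , x∈V , y∉V = separate x y x≢y in V , O , x∈V , λ _ → y∉V

  ｛_｝ : Fin n → Subset n
  ｛ x ｝ = ⋂ (λ y → proj₁ (neighbourhood-avoiding x y))

  Open-｛｝ : ∀ x → Open ｛ x ｝
  Open-｛｝ x = Open-⋂ _ (λ y → proj₁ (proj₂ (neighbourhood-avoiding x y)))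

  x∈｛x｝ : ∀ x → x ∈ ｛ x ｝
  x∈｛x｝ x = ∈-⋂ _ (λ y → proj₁ (proj₂ (proj₂ (neighbourhood-avoiding x y))))

  ∈｛｝⇒≡ : ∀ {x y} → y ∈ ｛ x ｝ → x ≡ y
  ∈｛｝⇒≡ {x} {y} y∈｛x｝ = decidable-stable (x ≟ y) λ x≢y →
    proj₂ (proj₂ (proj₂ (neighbourhood-avoiding x y))) x≢y (⋂-⊆ _ y y∈｛x｝)

  discrete : ∀ S → Open S
  discrete S = Open-ext (⋃ piece) S (λ x → T-extensional (⋃⇒S x) (S⇒⋃ x))
                        (Open-⋃ piece Open-piece)
    where
    piece : Fin n → Subset n
    piece i w = S i ∧ ｛ i ｝ w

    Open-piece : ∀ i → Open (λ w → S i ∧ ｛ i ｝ w)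
    Open-piece i with S i
    ... | true  = Open-｛｝ i
    ... | false = Open-∅

    ⋃⇒S : ∀ x → x ∈ ⋃ piece → x ∈ S
    ⋃⇒S x x∈⋃ with ∈-⋃⁻ piece x∈⋃
    ... | i , x∈piece with Equivalence.to T-∧ x∈piece
    ...   | i∈S , x∈｛i｝ = subst (_∈ S) (∈｛｝⇒≡ x∈｛i｝) i∈S

    S⇒⋃ : ∀ x → x ∈ S → x ∈ ⋃ piece
    S⇒⋃ x x∈S = ⊆-⋃ piece x (Equivalence.from T-∧ (x∈S , x∈｛x｝ x))

module _ {n : ℕ} (X : FinTemporalEsakia n) where
  open FinTemporalEsakia X

  ≤-refl : ∀ {a} → a ≤ a
  ≤-refl = inj₁ refl

  _≤?_ : Decidable₂ _≤_
  a ≤? b = (a ≟ b) ⊎-dec T? (r▷ a b)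

  _<?_ : Decidable₂ _<_
  a <? b = (a ≤? b) ×-dec ¬? (a ≟ b)

  _B?_ : Decidable₂ _B_
  a B? b = (b ≤? a) ×-dec all? (λ v → b <? v →-dec v ≤? a →-dec ¬? (T? (r▷ v v)))

  Refl-between? : ∀ a z → Decidable (λ v → a < v × v ≤ z × Refl v)
  Refl-between? a z v = (a <? v) ×-dec (v ≤? z) ×-dec T? (r▷ v v)

  ≤-isPartialOrder : IsPartialOrder _≡_ _≤_
  ≤-isPartialOrder = record
    { isPreorder = record
      { isEquivalence = isEquivalence
      ; reflexive     = inj₁
      ; trans         = λ {a} {b} {c} → ≤-trans a b c
      }
    ; antisym = λ {a} {b} → ≤-antisym a b
    }

  <-trans : ∀ {a b c} → a < b → b < c → a < c
  <-trans = ToStrict.<-trans _≡_ _≤_ ≤-isPartialOrder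

  <⇒R▷ : ∀ {a b} → a < b → a R▷ b
  <⇒R▷ (inj₁ a≡b , a≢b) = ⊥-elim (a≢b a≡b)
  <⇒R▷ (inj₂ aR▷b , _) = aR▷b

  Refl-≤⇒R▷ : ∀ {a b} → Refl a → a ≤ b → a R▷ b
  Refl-≤⇒R▷ aR▷a (inj₁ refl) = aR▷a
  Refl-≤⇒R▷ _    (inj₂ aR▷b) = aR▷b

  ∃-<-minimal : ∀ {p} {P : Pred (Fin n) p} → Decidable P →
                ∀ {a} → P a → ∃[ b ] (P b × ∀ c → P c → ¬ c < b)
  ∃-<-minimal = ∃-minimal (po-wellFounded ≤-isPartialOrder) _<?_

  ∃-<-maximal : ∀ {p} {P : Pred (Fin n) p} → Decidable P →
                ∀ {a} → P a → ∃[ b ] (P b × ∀ c → P c → ¬ b < c)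
  ∃-<-maximal = ∃-minimal (po-noetherian ≤-isPartialOrder) (flip _<?_)

  priestley⇒T₁ : ∀ x y → x ≢ y → ∃[ V ] (Open V × x ∈ V × ¬ y ∈ V)
  priestley⇒T₁ x y x≢y with x ≤? y
  ... | no x≰y = let U , (U-open , _) , _ , x∈U , y∉U = priestley x y x≰y
                 in U , U-open , x∈U , y∉U
  ... | yes x≤y = let U , (_ , U-closed) , _ , y∈U , x∉U = priestley y x y≰x
                  in ∁ U , U-closed , ¬T⇒T-not x∉U , T⇒¬T-not y∈U
    where
    y≰x : ¬ y ≤ x
    y≰x y≤x = x≢y (≤-antisym x y x≤y y≤x)

  open FiniteT₁Space Open Open-ext Open-∅ Open-full Open-∪ Open-∩ priestley⇒T₁
    using (discrete)

  B-refl : ∀ {a} → a B a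
  B-refl {a} = ≤-refl , λ v (a≤v , a≢v) v≤a _ → a≢v (≤-antisym a v a≤v v≤a)

  _⇝_ : Fin n → Fin n → Set
  y ⇝ z = ∃[ u ] (y B u × u ≤ z)

  ≤⇒⇝ : ∀ {y z} → y ≤ z → y ⇝ z
  ≤⇒⇝ y≤z = _ , B-refl , y≤z

  Zₙ? : ∀ k x → Decidable (Zₙ k x)
  Zₙ? zero    x z = x ≟ z
  Zₙ? (suc k) x z = any? (λ y → Zₙ? k x y ×-dec any? (λ u → (y B? u) ×-dec (u ≤? z)))

  Zₙ-suc : ∀ {k x z} → Zₙ k x z → Zₙ (suc k) x z
  Zₙ-suc xZₖz = _ , xZₖz , ≤⇒⇝ ≤-refl

  Zₙ-refl : ∀ k {x} → Zₙ k x x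
  Zₙ-refl zero    = refl
  Zₙ-refl (suc k) = Zₙ-suc (Zₙ-refl k)

  archival-minimal-Refl : ∀ {S} → Archival S → ∀ {u m} → ¬ u ∈ S → m ∈ S → u < m →
                         (∀ w → u ≤ w → w ∈ S → w ≤ m → w ≡ m) → Refl m
  archival-minimal-Refl archival {m = m} u∉S m∈S u<m minimal
    with archival _ _ u∉S m∈S (<⇒R▷ u<m)
  ... | w , wR▷m , u≤w , w∈S = subst (_R▷ m) (minimal w u≤w w∈S (inj₂ wR▷m)) wR▷m

  archival-B-closed : ∀ {S} → Archival S → ∀ {y u} → y ∈ S → y B u → u ∈ S
  archival-B-closed {S} archival {y} {u} y∈S (u≤y , no-Refl-between)
    with ∃-<-minimal (λ w → (u ≤? w) ×-dec (w ≤? y) ×-dec T? (S w)) (u≤y , ≤-refl , y∈S)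
  ... | m , (u≤m , m≤y , m∈S) , minimal = decidable-stable (T? (S u)) λ u∉S →
    let u<m = u≤m , λ u≡m → u∉S (subst (_∈ S) (sym u≡m) m∈S)
    in  no-Refl-between m u<m m≤y (archival-minimal-Refl archival u∉S m∈S u<m minimal≡)
    where
    minimal≡ : ∀ w → u ≤ w → w ∈ S → w ≤ m → w ≡ m
    minimal≡ w u≤w w∈S w≤m = decidable-stable (w ≟ m) λ w≢m →
      minimal w (u≤w , ≤-trans w m y w≤m m≤y , w∈S) (w≤m , w≢m)

  Z⇒⊴ : ∀ {x y} → x Z y → x ⊴ y
  Z⇒⊴ {x} (k , xZₖy) S _ archival upset x∈S = reached k xZₖy
    where
    reached : ∀ k {z} → Zₙ k x z → z ∈ S
    reached zero    refl                       = x∈S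
    reached (suc k) (y , xZₖy , u , yBu , u≤z) =
      upset u _ u≤z (archival-B-closed archival (reached k xZₖy) yBu)

  module Reachable (x : Fin n) where

    stage : ℕ → Subset n
    stage k z = isYes (Zₙ? k x z)

    stabilisation : ∃[ j ] (∀ {z} → z ∈ stage (suc j) → z ∈ stage j)
    stabilisation = ascending-chain-stabilises stage (λ k → fromWitness ∘ Zₙ-suc ∘ toWitness)

    Reach : Subset n
    Reach = stage (proj₁ stabilisation)

    ∈Reach⇒Z : ∀ {z} → z ∈ Reach → x Z z
    ∈Reach⇒Z z∈Reach = proj₁ stabilisation , toWitness z∈Reach

    x∈Reach : x ∈ Reach
    x∈Reach = fromWitness (Zₙ-refl _)

    Reach-⇝-closed : ∀ {y z} → y ∈ Reach → y ⇝ z → z ∈ Reach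
    Reach-⇝-closed y∈Reach y⇝z = proj₂ stabilisation (fromWitness (_ , toWitness y∈Reach , y⇝z))

    Reach-upset : IsUpset (_∈ Reach)
    Reach-upset _ _ y≤z y∈Reach = Reach-⇝-closed y∈Reach (≤⇒⇝ y≤z)

    Reach-archival : Archival Reach
    Reach-archival x' z x'∉Reach z∈Reach x'R▷z with any? (Refl-between? x' z)
    ... | no ∄Refl-between = ⊥-elim (x'∉Reach (Reach-⇝-closed z∈Reach (x' , zBx' , ≤-refl)))
      where
      zBx' : z B x'
      zBx' = inj₂ x'R▷z , λ v x'<v v≤z v-Refl → ∄Refl-between (v , x'<v , v≤z , v-Refl)
    ... | yes (_ , Refl-between) with ∃-<-maximal (Refl-between? x' z) Refl-between
    ...   | m , (x'<m , m≤z , m-Refl) , maximal =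
      m , Refl-≤⇒R▷ m-Refl m≤z , proj₁ x'<m , Reach-⇝-closed z∈Reach (m , zBm , ≤-refl)
      where
      zBm : z B m
      zBm = m≤z , λ v m<v v≤z v-Refl → maximal v (<-trans x'<m m<v , v≤z , v-Refl) m<v

  ⊴⇒Z : ∀ {x y} → x ⊴ y → x Z y
  ⊴⇒Z {x} x⊴y =
    ∈Reach⇒Z (x⊴y Reach (discrete (∁ Reach)) Reach-archival Reach-upset x∈Reach)
    where open Reachable x

proposition4p9 : (n : ℕ) (X : FinTemporalEsakia n) (x y : Fin n) →
    FinTemporalEsakia._⊴_ X x y ⇔ FinTemporalEsakia._Z_ X x y
proposition4p9 n X x y = ⊴⇒Z X , Z⇒⊴ X
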